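{- Let $P$ be a nonempty finite poset, $d'(P)=\max\{d(P|_A)\mid A \text{ a proper subset of the ground set}\}$ and $\varepsilon(P)=d'(P)/d(P)$. Then $\varepsilon(P)\le 1-1/d(P)$, and for all integers $m\ge (m(P)+1)\,d(P)\ln 2$, $$1\le\frac{e(m+1,P)}{d(P)\,e(m,P)}\le 1+2^{m(P)}\varepsilon(P)^m;$$ thus $\frac{e(m+1,P)}{d(P)e(m,P)}=1+O(\varepsilon(P)^m)$, and $e(m+1,P)$ is asymptotically equal to $d(P)\,e(m,P)$ as $m\to\infty$.
   Context: $d(\cdot)$ is the number of downsets of a finite poset, $P|_A$ the induced subposet, $m(P)$ the number of minimal elements of $P$. For a finite poset $P$ on $K$ and a finite set $M$ disjoint from $K$ with $|M|=m$, $e(m,P)$ is the number of partial orders on $M\cup K$ inducing $P$ on $K$ whose set of minimal elements is exactly $M$. -}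

module Defs where

open import Data.Bool using (Bool; true; false; T)
open import Data.Nat as ℕ using (ℕ; zero; suc; _+_; _⊔_)
open import Data.Fin using (Fin; _↑ˡ_; _↑ʳ_; _≟_)
open import Data.Fin.Properties using (all?; any?)
open import Data.List using (List; []; _∷_; _++_; map; filter; length; foldr; concatMap; allFin)
open import Data.Vec.Functional using (Vector) renaming ([] to []ᵛ; _∷_ to _∷ᵛ_)
open import Data.Product using (_×_; ∃)
open import Data.Integer using (+_)
open import Data.Rational using (ℚ; 0ℚ; 1ℚ; _/_)
import Data.Rational as ℚ
open import Relation.Binary.PropositionalEquality using (_≡_)
open import Relation.Nullary using (Dec; ¬_; ¬?)
open import Relation.Nullary.Decidable using (T?; _→-dec_; _×-dec_)

record FinPoset (n : ℕ) : Set where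
  field
    le      : Fin n → Fin n → Bool
    refl    : ∀ x → T (le x x)
    antisym : ∀ x y → T (le x y) → T (le y x) → x ≡ y
    trans   : ∀ x y z → T (le x y) → T (le y z) → T (le x z)
open FinPoset public

IsPartialOrder : ∀ {N} → (Fin N → Fin N → Bool) → Set
IsPartialOrder r =
  (∀ x → T (r x x)) ×
  (∀ x y → T (r x y) → T (r y x) → x ≡ y) ×
  (∀ x y z → T (r x y) → T (r y z) → T (r x z))

isPartialOrder? : ∀ {N} (r : Fin N → Fin N → Bool) → Dec (IsPartialOrder r)
isPartialOrder? r =
  all? (λ x → T? (r x x)) ×-dec
  (all? λ x → all? λ y → T? (r x y) →-dec (T? (r y x) →-dec (x ≟ y))) ×-dec
  (all? λ x → all? λ y → all? λ z → T? (r x y) →-dec (T? (r y z) →-dec T? (r x z)))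

allFuns : ∀ {A : Set} → List A → (n : ℕ) → List (Vector A n)
allFuns as zero    = []ᵛ ∷ []
allFuns as (suc n) = concatMap (λ a → map (a ∷ᵛ_) (allFuns as n)) as

allSubsets : (n : ℕ) → List (Fin n → Bool)
allSubsets = allFuns (true ∷ false ∷ [])

allRels : (N : ℕ) → List (Fin N → Fin N → Bool)
allRels N = allFuns (allSubsets N) N

count : ∀ {A : Set} {P : A → Set} → (∀ x → Dec (P x)) → List A → ℕ
count P? xs = length (filter P? xs)

maximum : List ℕ → ℕ
maximum = foldr _⊔_ 0

IsDownsetOn : ∀ {n} → FinPoset n → (Fin n → Bool) → (Fin n → Bool) → Set
IsDownsetOn P A S =
  (∀ x → T (S x) → T (A x)) ×
  (∀ x y → T (S x) → T (A y) → T (le P y x) → T (S y))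

isDownsetOn? : ∀ {n} (P : FinPoset n) (A S : Fin n → Bool) → Dec (IsDownsetOn P A S)
isDownsetOn? P A S =
  (all? λ x → T? (S x) →-dec T? (A x)) ×-dec
  (all? λ x → all? λ y → T? (S x) →-dec (T? (A y) →-dec (T? (le P y x) →-dec T? (S y))))

dOn : ∀ {n} → FinPoset n → (Fin n → Bool) → ℕ
dOn {n} P A = count (isDownsetOn? P A) (allSubsets n)

d : ∀ {n} → FinPoset n → ℕ
d P = dOn P (λ _ → true)

IsProper : ∀ {n} → (Fin n → Bool) → Set
IsProper A = ∃ λ x → ¬ T (A x)

isProper? : ∀ {n} (A : Fin n → Bool) → Dec (IsProper A)
isProper? A = any? λ x → ¬? (T? (A x))

d′ : ∀ {n} → FinPoset n → ℕ
d′ {n} P = maximum (map (dOn P) (filter isProper? (allSubsets n)))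

IsMinimal : ∀ {N} → (Fin N → Fin N → Bool) → Fin N → Set
IsMinimal r x = ∀ y → T (r y x) → y ≡ x

isMinimal? : ∀ {N} (r : Fin N → Fin N → Bool) (x : Fin N) → Dec (IsMinimal r x)
isMinimal? r x = all? λ y → T? (r y x) →-dec (y ≟ x)

mP : ∀ {n} → FinPoset n → ℕ
mP {n} P = count (isMinimal? (le P)) (allFin n)

-- e(m,P): the ground set is Fin (m + n); M = Fin m ↑ˡ n, K = m ↑ʳ Fin n.

IsExtension : ∀ m {n} → FinPoset n → (Fin (m + n) → Fin (m + n) → Bool) → Set
IsExtension m {n} P r =
  IsPartialOrder r ×
  (∀ i j → r ((m ↑ʳ i)) ((m ↑ʳ j)) ≡ le P i j) ×
  (∀ (i : Fin m) → IsMinimal r (i ↑ˡ n)) ×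
  (∀ (j : Fin n) → ¬ IsMinimal r ((m ↑ʳ j)))

isExtension? : ∀ m {n} (P : FinPoset n) (r : Fin (m + n) → Fin (m + n) → Bool) →
               Dec (IsExtension m P r)
isExtension? m {n} P r =
  isPartialOrder? r ×-dec
  (all? λ i → all? λ j → Data.Bool._≟_ (r ((m ↑ʳ i)) ((m ↑ʳ j))) (le P i j)) ×-dec
  (all? λ i → isMinimal? r (i ↑ˡ n)) ×-dec
  (all? λ j → ¬? (isMinimal? r ((m ↑ʳ j))))
  where import Data.Bool

e : ℕ → ∀ {n} → FinPoset n → ℕ
e m {n} P = count (isExtension? m P) (allRels (m + n))

-- ln 2 = Σ_{k ≥ 1} 1 / (k 2^k); partial sums (increasing, converging to ln 2).

half : ℚ
half = + 1 / 2

halfPow : ℕ → ℚ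
halfPow zero    = 1ℚ
halfPow (suc k) = half ℚ.* halfPow k

lnTwoPartial : ℕ → ℚ
lnTwoPartial zero    = 0ℚ
lnTwoPartial (suc N) = lnTwoPartial N ℚ.+ (+ 1 / suc N) ℚ.* halfPow (suc N)

-- The real inequality  x · ln 2 ≤ m  (for natural x, m).
LnTwoTimesLe : ℕ → ℕ → Set
LnTwoTimesLe x m = ∀ N → (+ x / 1) ℚ.* lnTwoPartial N ℚ.≤ (+ m / 1)

-- An extension of P in which M is exactly the set of minimal elements is determined by the
-- sets D_i ⊆ K of elements not above i ∈ M. These are downsets of P, and the only constraint on
-- the m-tuple (D_i) is that every minimal element of P lies outside some D_i ("covering").
-- So e(m,P) counts covering m-tuples of downsets. Prepending any downset keeps a tuple covering,
-- whence d·e(m) ≤ e(m+1), and e(m+1) ≤ d^(m+1). A non-covering tuple has a minimal x in every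
-- D_i, and removing x leaves downsets of P|_(K∖x); hence d^m ≤ e(m) + m(P)·d'^m. Finally
-- d' < d, as S ↦ ↓S embeds the downsets of P|_A into those of P, missing ↓x for x ∉ A; and
-- 2·m(P)·d'^m ≤ d^m, as (1 + 1/(d-1))^m ≥ e^(m/d) ≥ 2^(m(P)+1) for m ≥ (m(P)+1)·d·ln 2 (already
-- ln 2 > 2/3, (1 + 1/t)^(t+1) ≥ 2 and Bernoulli's inequality suffice).
-- Then e(m+1)/(d·e(m)) ≤ d^m/e(m) ≤ 1 + 2^(m(P))·(d'/d)^m.

module Submission where

open import Defs renaming (refl to le-refl; antisym to le-antisym; trans to le-trans)
open import Data.Bool using (Bool; true; false; T; not; _∧_)
open import Data.Bool.Properties using (not-injective; T-∧; ∧-identityʳ)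
open import Data.Nat using (ℕ; zero; suc; _+_; _*_; _^_; _≤_; _<_; z≤n; s≤s)
open import Data.Nat.Properties
  using ( ≤-reflexive; ≤-trans; ≤-antisym; +-comm; +-suc; +-identityʳ; *-identityˡ; *-comm; *-assoc
        ; *-distribˡ-+; ^-distribˡ-+-*; +-mono-≤; +-monoˡ-≤; +-monoʳ-≤; *-mono-≤; *-monoˡ-≤; *-monoʳ-≤
        ; ^-monoˡ-≤; +-cancelˡ-≤; +-cancelʳ-≤; *-cancelˡ-≤; m≤m+n; m≤n+m; n≤1+n; m≤n⇒∃[o]m+o≡n
        ; m≤m⊔n; m≤n⊔m; ⊔-lub; module ≤-Reasoning)
open import Data.Nat.Tactic.RingSolver using (solve-∀)
open import Data.Fin using (Fin; _↑ˡ_; _↑ʳ_; _≟_; splitAt; join) renaming (zero to fzero; suc to fsuc)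
import Data.Fin.Properties as Finₚ
import Data.Integer as ℤ
import Data.Integer.Properties as ℤₚ
import Data.Rational as ℚ
import Data.Rational.Properties as ℚₚ
import Data.Rational.Unnormalised as ℚᵘ
open ℚᵘ using (mkℚᵘ)
import Data.Rational.Unnormalised.Properties as ℚᵘₚ
open import Data.Product using (∃; _×_; _,_; proj₁; proj₂)
open import Data.Product.Relation.Binary.Pointwise.NonDependent using (_×ₛ_)
open import Data.Sum using (_⊎_; inj₁; inj₂)
open import Data.Unit using (tt)
open import Data.List
  using (List; []; _∷_; _++_; map; filter; length; concatMap; cartesianProductWith; cartesianProduct; allFin)
open import Data.List.Properties using (length-++; length-map; length-removeAt′; length-filter; filter-≐)
open import Data.List.Relation.Unary.All as All using (All; []; _∷_)
import Data.List.Relation.Unary.All.Properties as Allₚ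
open import Data.List.Relation.Unary.Any as Any using (Any; here; there; index; _─_)
import Data.List.Relation.Unary.Any.Properties as Anyₚ
open import Data.List.Relation.Unary.AllPairs using () renaming ([] to []ᵖ; _∷_ to _∷ᵖ_)
open import Data.List.Relation.Unary.Unique.Setoid using (Unique)
import Data.List.Relation.Unary.Unique.Setoid.Properties as Unique
open import Data.List.Membership.Propositional using (_∈_)
import Data.List.Membership.Propositional.Properties as Membershipₚ
import Data.List.Membership.Setoid as SetoidMembership
import Data.List.Membership.Setoid.Properties as SetoidMembershipₚ
open import Data.Vec.Functional using (Vector) renaming (_∷_ to _∷ᵛ_)
open import Data.Vec.Functional.Relation.Binary.Pointwise.Properties using () renaming (setoid to vecSetoid)
open import Function using (Equivalence)
open import Level using (0ℓ)
open import Relation.Binary.Bundles using (Setoid)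
open import Relation.Binary.Definitions using (_Respects_)
open import Relation.Binary.PropositionalEquality as ≡
  using (_≡_; _≢_; refl; sym; trans; cong; cong₂; subst; subst₂)
open import Relation.Nullary using (¬_; Dec; yes; no; ¬?; contradiction)
open import Relation.Nullary.Decidable
  using (⌊_⌋; toWitness; fromWitness; T?; _×-dec_; _→-dec_; decidable-stable)
open import Relation.Unary using (Pred; Decidable)
open import Relation.Unary.Properties using (∁?)

-- Counting by injections

module _ (S T : Setoid 0ℓ 0ℓ) where
  open Setoid S using () renaming (Carrier to A; _≈_ to _≈₁_)
  open Setoid T using () renaming (Carrier to B; _≈_ to _≈₂_; sym to sym₂; trans to trans₂)
  open SetoidMembership T using () renaming (_∈_ to _∈₂_)

  ∈-─⁺ : ∀ {y z ys} (y∈ys : y ∈₂ ys) → z ∈₂ ys → ¬ y ≈₂ z → z ∈₂ (ys ─ y∈ys)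
  ∈-─⁺ (here y≈w) (here z≈w) y≉z = contradiction (trans₂ y≈w (sym₂ z≈w)) y≉z
  ∈-─⁺ (here _)   (there z∈ys) _ = z∈ys
  ∈-─⁺ (there _)  (here z≈w)   _ = here z≈w
  ∈-─⁺ (there y∈ys) (there z∈ys) y≉z = there (∈-─⁺ y∈ys z∈ys y≉z)

  length-≤-injection : ∀ {f : A → B} {xs ys} → Unique S xs →
                       (∀ {x y} → x ∈ xs → y ∈ xs → f x ≈₂ f y → x ≈₁ y) →
                       (∀ {x} → x ∈ xs → f x ∈₂ ys) →
                       length xs ≤ length ys
  length-≤-injection {xs = []} _ _ _ = z≤n
  length-≤-injection {f} {x ∷ xs} {ys} (x∉xs ∷ᵖ xs!) inj into = begin
    suc (length xs)           ≤⟨ s≤s (length-≤-injection xs! (λ p q → inj (there p) (there q)) into′) ⟩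
    suc (length (ys ─ fx∈ys)) ≡⟨ length-removeAt′ ys (index fx∈ys) ⟨
    length ys                 ∎
    where
    open ≤-Reasoning
    fx∈ys = into (here refl)
    into′ : ∀ {y} → y ∈ xs → f y ∈₂ (ys ─ fx∈ys)
    into′ p = ∈-─⁺ fx∈ys (into (there p)) (λ e → All.lookup x∉xs p (inj (here refl) (there p) e))

  length-<-injection : ∀ {f : A → B} {xs ys z} → Unique S xs →
                       (∀ {x y} → x ∈ xs → y ∈ xs → f x ≈₂ f y → x ≈₁ y) →
                       (∀ {x} → x ∈ xs → f x ∈₂ ys) →
                       (z∈ys : z ∈₂ ys) → (∀ {x} → x ∈ xs → ¬ f x ≈₂ z) →
                       length xs < length ys
  length-<-injection {f} {xs} {ys} xs! inj into z∈ys missed = begin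
    suc (length xs)          ≤⟨ s≤s (length-≤-injection xs! inj into′) ⟩
    suc (length (ys ─ z∈ys)) ≡⟨ length-removeAt′ ys (index z∈ys) ⟨
    length ys                ∎
    where
    open ≤-Reasoning
    into′ : ∀ {x} → x ∈ xs → f x ∈₂ (ys ─ z∈ys)
    into′ p = ∈-─⁺ z∈ys (into p) (λ e → missed p (sym₂ e))

  module _ {P : Pred A 0ℓ} {Q : Pred B 0ℓ} (P? : Decidable P) (Q? : Decidable Q)
           (Q-resp : Q Respects _≈₂_) {f : A → B} {xs ys} (xs! : Unique S xs)
           (inj : ∀ {x y} → x ∈ xs → P x → y ∈ xs → P y → f x ≈₂ f y → x ≈₁ y)
           (into : ∀ {x} → x ∈ xs → P x → f x ∈₂ ys × Q (f x)) where

    private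
      inj′ : ∀ {x y} → x ∈ filter P? xs → y ∈ filter P? xs → f x ≈₂ f y → x ≈₁ y
      inj′ p q with Membershipₚ.∈-filter⁻ P? p | Membershipₚ.∈-filter⁻ P? q
      ... | p′ , px | q′ , py = inj p′ px q′ py

      into′ : ∀ {x} → x ∈ filter P? xs → f x ∈₂ filter Q? ys
      into′ p with Membershipₚ.∈-filter⁻ P? p
      ... | p′ , px = SetoidMembershipₚ.∈-filter⁺ T Q? Q-resp (proj₁ (into p′ px)) (proj₂ (into p′ px))

    count-≤-injection : count P? xs ≤ count Q? ys
    count-≤-injection = length-≤-injection (Unique.filter⁺ S P? xs!) inj′ into′

    count-<-injection : ∀ {z} → z ∈₂ ys → Q z → (∀ {x} → x ∈ xs → P x → ¬ f x ≈₂ z) →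
                        count P? xs < count Q? ys
    count-<-injection z∈ys qz missed =
      length-<-injection (Unique.filter⁺ S P? xs!) inj′ into′
        (SetoidMembershipₚ.∈-filter⁺ T Q? Q-resp z∈ys qz)
        (λ p → let p′ , px = Membershipₚ.∈-filter⁻ P? p in missed p′ px)

-- Enumerations of functions

concatMap-map≡cartesianProductWith : ∀ {A B C : Set} (f : A → B → C) xs ys →
  concatMap (λ a → map (f a) ys) xs ≡ cartesianProductWith f xs ys
concatMap-map≡cartesianProductWith f []       ys = refl
concatMap-map≡cartesianProductWith f (x ∷ xs) ys =
  cong (map (f x) ys ++_) (concatMap-map≡cartesianProductWith f xs ys)

length-cartesianProductWith : ∀ {A B C : Set} (f : A → B → C) xs ys →
  length (cartesianProductWith f xs ys) ≡ length xs * length ys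
length-cartesianProductWith f []       ys = refl
length-cartesianProductWith f (x ∷ xs) ys = trans (length-++ (map (f x) ys))
  (cong₂ _+_ (length-map (f x) ys) (length-cartesianProductWith f xs ys))

allFuns-suc : ∀ {A : Set} (as : List A) n →
  allFuns as (suc n) ≡ cartesianProductWith _∷ᵛ_ as (allFuns as n)
allFuns-suc as n = concatMap-map≡cartesianProductWith _∷ᵛ_ as (allFuns as n)

length-allFuns : ∀ {A : Set} (as : List A) n → length (allFuns as n) ≡ length as ^ n
length-allFuns as zero    = refl
length-allFuns as (suc n) = trans (cong length (allFuns-suc as n))
  (trans (length-cartesianProductWith _∷ᵛ_ as (allFuns as n)) (cong (length as *_) (length-allFuns as n)))

∈-allFuns⁻ : ∀ {A : Set} {as : List A} n {v} → v ∈ allFuns as n → ∀ i → v i ∈ as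
∈-allFuns⁻ {as = as} (suc n) v∈ i
  with Membershipₚ.∈-cartesianProductWith⁻ _∷ᵛ_ as (allFuns as n) (subst (_ ∈_) (allFuns-suc as n) v∈) | i
... | _ , _ , a∈as , _  , refl | fzero  = a∈as
... | _ , _ , _    , w∈ , refl | fsuc j = ∈-allFuns⁻ n w∈ j

module _ (S : Setoid 0ℓ 0ℓ) where
  open Setoid S using (_≈_) renaming (Carrier to A; refl to ≈-refl)
  open SetoidMembership S using () renaming (_∈_ to _∈ₛ_)

  private
    _∈ᵥ_ : ∀ {n} → Vector A n → List (Vector A n) → Set
    _∈ᵥ_ {n} = SetoidMembership._∈_ (vecSetoid S n)

  allFuns⁺ : ∀ {as} → Unique S as → ∀ n → Unique (vecSetoid S n) (allFuns as n)
  allFuns⁺ as! zero    = [] ∷ᵖ []ᵖ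
  allFuns⁺ {as} as! (suc n) = subst (Unique (vecSetoid S (suc n))) (sym (allFuns-suc as n))
    (Unique.cartesianProductWith⁺ S (vecSetoid S n) (vecSetoid S (suc n)) _∷ᵛ_
      (λ e → e fzero , λ i → e (fsuc i)) as! (allFuns⁺ as! n))

  ∈-allFuns⁺ : ∀ {as} n {v : Vector A n} → (∀ i → v i ∈ₛ as) → v ∈ᵥ allFuns as n
  ∈-allFuns⁺ zero    _   = here (λ ())
  ∈-allFuns⁺ {as} (suc n) {v} v∈ = subst (v ∈ᵥ_) (sym (allFuns-suc as n))
    (SetoidMembershipₚ.∈-resp-≈ (vecSetoid S (suc n)) (λ { fzero → ≈-refl ; (fsuc i) → ≈-refl })
      (SetoidMembershipₚ.∈-cartesianProductWith⁺ S (vecSetoid S n) (vecSetoid S (suc n))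
        (λ { e e′ fzero → e ; e e′ (fsuc i) → e′ i }) (v∈ fzero) (∈-allFuns⁺ n (λ i → v∈ (fsuc i)))))

≤-maximum : ∀ {v xs} → Any (v ≤_) xs → v ≤ maximum xs
≤-maximum {xs = x ∷ xs} (here v≤x)   = ≤-trans v≤x (m≤m⊔n x (maximum xs))
≤-maximum {xs = x ∷ xs} (there v≤xs) = ≤-trans (≤-maximum v≤xs) (m≤n⊔m x (maximum xs))

maximum-< : ∀ {v xs} → 0 < v → All (_< v) xs → maximum xs < v
maximum-< 0<v []         = 0<v
maximum-< 0<v (x<v ∷ xs<v) = ⊔-lub x<v (maximum-< 0<v xs<v)

length≡count+count∁ : ∀ {A : Set} {P : Pred A 0ℓ} (P? : Decidable P) xs →
                      length xs ≡ count P? xs + count (∁? P?) xs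
length≡count+count∁ P? [] = refl
length≡count+count∁ P? (x ∷ xs) with P? x
... | yes _ = cong suc (length≡count+count∁ P? xs)
... | no  _ = trans (cong suc (length≡count+count∁ P? xs)) (sym (+-suc _ _))

length-concatMap-≤ : ∀ {A B : Set} (g : A → List B) {b} → (∀ x → length (g x) ≤ b) →
                     ∀ xs → length (concatMap g xs) ≤ length xs * b
length-concatMap-≤ g g≤b []       = z≤n
length-concatMap-≤ g g≤b (x ∷ xs) = ≤-trans (≤-reflexive (length-++ (g x)))
  (+-mono-≤ (g≤b x) (length-concatMap-≤ g g≤b xs))

-- Subsets and downsets

T-not⁺ : ∀ {b} → ¬ T b → T (not b)
T-not⁺ {false} _   = tt
T-not⁺ {true}  ¬tt = ¬tt tt

T-not⁻ : ∀ {b} → T (not b) → ¬ T b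
T-not⁻ {true} ()

T-ext : ∀ {a b} → (T a → T b) → (T b → T a) → a ≡ b
T-ext {false} {false} _ _ = refl
T-ext {false} {true}  _ g = contradiction (g tt) λ ()
T-ext {true}  {false} f _ = contradiction (f tt) λ ()
T-ext {true}  {true}  _ _ = refl

Subset : ℕ → Set
Subset n = Fin n → Bool

subsetSetoid : ℕ → Setoid 0ℓ 0ℓ
subsetSetoid = vecSetoid (≡.setoid Bool)

relationSetoid : ℕ → Setoid 0ℓ 0ℓ
relationSetoid N = vecSetoid (subsetSetoid N) N

module _ {n : ℕ} where
  open SetoidMembership (subsetSetoid n) public using () renaming (_∈_ to _∈ₛ_)
  open Setoid (subsetSetoid n) public using () renaming (_≈_ to _≋_)

∈-bools : ∀ b → b ∈ true ∷ false ∷ []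
∈-bools true  = here refl
∈-bools false = there (here refl)

allSubsets⁺ : ∀ n → Unique (subsetSetoid n) (allSubsets n)
allSubsets⁺ = allFuns⁺ (≡.setoid Bool) (((λ ()) ∷ []) ∷ᵖ [] ∷ᵖ []ᵖ)

∈-allSubsets : ∀ {n} (A : Subset n) → A ∈ₛ allSubsets n
∈-allSubsets A = ∈-allFuns⁺ (≡.setoid Bool) _ (λ i → ∈-bools (A i))

allRels⁺ : ∀ N → Unique (relationSetoid N) (allRels N)
allRels⁺ N = allFuns⁺ (subsetSetoid N) (allSubsets⁺ N) N

∈-allRels : ∀ {N} (r : Fin N → Fin N → Bool) → SetoidMembership._∈_ (relationSetoid N) r (allRels N)
∈-allRels r = ∈-allFuns⁺ (subsetSetoid _) _ (λ i → ∈-allSubsets (r i))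

module _ {n : ℕ} (P : FinPoset n) where

  Downset : Subset n → Set
  Downset = IsDownsetOn P (λ _ → true)

  downset? : ∀ S → Dec (Downset S)
  downset? = isDownsetOn? P (λ _ → true)

  downsets : List (Subset n)
  downsets = filter downset? (allSubsets n)

  IsDownsetOn-resp : ∀ {A A′ S S′} → A ≋ A′ → S ≋ S′ → IsDownsetOn P A S → IsDownsetOn P A′ S′
  IsDownsetOn-resp A≋A′ S≋S′ (S⊆A , closed) =
    (λ x Sx → subst T (A≋A′ x) (S⊆A x (subst T (sym (S≋S′ x)) Sx))) ,
    (λ x y Sx Ay y≤x → subst T (S≋S′ y)
      (closed x y (subst T (sym (S≋S′ x)) Sx) (subst T (sym (A≋A′ y)) Ay) y≤x))

  Downset-resp : ∀ {S S′} → S ≋ S′ → Downset S → Downset S′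
  Downset-resp = IsDownsetOn-resp (λ _ → refl)

  downsets⁺ : Unique (subsetSetoid n) downsets
  downsets⁺ = Unique.filter⁺ (subsetSetoid n) downset? (allSubsets⁺ n)

  ∈-downsets : ∀ {S} → Downset S → S ∈ₛ downsets
  ∈-downsets {S} = SetoidMembershipₚ.∈-filter⁺ (subsetSetoid n) downset? Downset-resp (∈-allSubsets S)

  ∈-downsets⁻ : ∀ {S} → S ∈ downsets → Downset S
  ∈-downsets⁻ S∈ = proj₂ (Membershipₚ.∈-filter⁻ downset? {xs = allSubsets n} S∈)

  dOn-cong : ∀ {A A′} → A ≋ A′ → dOn P A ≡ dOn P A′
  dOn-cong {A} {A′} A≋A′ = cong length (filter-≐ (isDownsetOn? P A) (isDownsetOn? P A′)
    (IsDownsetOn-resp A≋A′ (λ _ → refl) , IsDownsetOn-resp (λ x → sym (A≋A′ x)) (λ _ → refl))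
    (allSubsets n))

  principal : Fin n → Subset n
  principal x y = le P y x

  principal-downset : ∀ x → Downset (principal x)
  principal-downset x = (λ _ _ → tt) , λ y z y≤x _ z≤y → le-trans P z y x z≤y y≤x

  downClosure : Subset n → Subset n
  downClosure S y = ⌊ Finₚ.any? (λ s → T? (S s) ×-dec T? (le P y s)) ⌋

  downClosure-intro : ∀ {S y} s → T (S s) → T (le P y s) → T (downClosure S y)
  downClosure-intro {S} {y} s Ss y≤s =
    fromWitness {a? = Finₚ.any? (λ s → T? (S s) ×-dec T? (le P y s))} (s , Ss , y≤s)

  downClosure-elim : ∀ {S y} → T (downClosure S y) → ∃ λ s → T (S s) × T (le P y s)
  downClosure-elim {S} {y} = toWitness {a? = Finₚ.any? (λ s → T? (S s) ×-dec T? (le P y s))}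

  downClosure-downset : ∀ S → Downset (downClosure S)
  downClosure-downset S = (λ _ _ → tt) , λ y z y∈↓S _ z≤y →
    let s , Ss , y≤s = downClosure-elim y∈↓S in downClosure-intro s Ss (le-trans P z y s z≤y y≤s)

  downClosure-reflects-⊆ : ∀ {A S S′} → IsDownsetOn P A S → IsDownsetOn P A S′ →
                           (∀ {y} → T (downClosure S y) → T (downClosure S′ y)) →
                           ∀ {y} → T (S y) → T (S′ y)
  downClosure-reflects-⊆ (S⊆A , _) (_ , S′-closed) ↓S⊆↓S′ {y} Sy =
    let s′ , S′s′ , y≤s′ = downClosure-elim (↓S⊆↓S′ (downClosure-intro y Sy (le-refl P y)))
    in S′-closed s′ y S′s′ (S⊆A y Sy) y≤s′

  dOn<d : ∀ A {x} → ¬ T (A x) → dOn P A < d P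
  dOn<d A {x} x∉A = count-<-injection (subsetSetoid n) (subsetSetoid n)
    (isDownsetOn? P A) downset? Downset-resp {f = downClosure} (allSubsets⁺ n) inj
    (λ {S} _ _ → ∈-allSubsets (downClosure S) , downClosure-downset S)
    (∈-allSubsets (principal x)) (principal-downset x) missed
    where
    inj : ∀ {S S′} → S ∈ allSubsets n → IsDownsetOn P A S → S′ ∈ allSubsets n → IsDownsetOn P A S′ →
          downClosure S ≋ downClosure S′ → S ≋ S′
    inj _ S↓ _ S′↓ ↓S≋↓S′ y = T-ext
      (downClosure-reflects-⊆ S↓ S′↓ (λ {z} → subst T (↓S≋↓S′ z)))
      (downClosure-reflects-⊆ S′↓ S↓ (λ {z} → subst T (sym (↓S≋↓S′ z))))
    missed : ∀ {S} → S ∈ allSubsets n → IsDownsetOn P A S → ¬ downClosure S ≋ principal x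
    missed _ (S⊆A , _) ↓S≋↓x =
      let s , Ss , x≤s = downClosure-elim (subst T (sym (↓S≋↓x x)) (le-refl P x))
          s≤x = subst T (↓S≋↓x s) (downClosure-intro s Ss (le-refl P s))
      in x∉A (subst (λ z → T (A z)) (le-antisym P s x s≤x x≤s) (S⊆A s Ss))

  dOn≤d′ : ∀ A {x} → ¬ T (A x) → dOn P A ≤ d′ P
  dOn≤d′ A {x} x∉A = ≤-maximum (Anyₚ.map⁺ (Any.map (λ A≋A′ → ≤-reflexive (dOn-cong A≋A′))
    (SetoidMembershipₚ.∈-filter⁺ (subsetSetoid n) isProper? proper-resp (∈-allSubsets A) (x , x∉A))))
    where
    proper-resp : ∀ {A A′} → A ≋ A′ → IsProper A → IsProper A′
    proper-resp A≋A′ (y , y∉A) = y , λ y∈A′ → y∉A (subst T (sym (A≋A′ y)) y∈A′)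

d′<d : ∀ {n} (P : FinPoset (suc n)) → d′ P < d P
d′<d {n} P = maximum-< (≤-trans (s≤s z≤n) (dOn<d P (λ _ → false) {fzero} λ ()))
  (Allₚ.map⁺ (All.map (λ (_ , x∉A) → dOn<d P _ x∉A) (Allₚ.all-filter isProper? (allSubsets (suc n)))))

-- Extensions by new minimal elements and covering tuples of downsets

data View (m n : ℕ) : Fin (m + n) → Set where
  new : (i : Fin m) → View m n (i ↑ˡ n)
  old : (k : Fin n) → View m n (m ↑ʳ k)

view : ∀ m n x → View m n x
view zero    n x        = old x
view (suc m) n fzero    = new fzero
view (suc m) n (fsuc x) with view m n x
... | new i = new (fsuc i)
... | old k = old k

↑ˡ≢↑ʳ : ∀ {m n} (i : Fin m) (k : Fin n) → i ↑ˡ n ≢ m ↑ʳ k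
↑ˡ≢↑ʳ {suc m} fzero    k ()
↑ˡ≢↑ʳ {suc m} (fsuc i) k e = ↑ˡ≢↑ʳ i k (Finₚ.suc-injective e)

¬IsMinimal⇒below : ∀ {N} (r : Fin N → Fin N → Bool) {z} → ¬ IsMinimal r z → ∃ λ y → T (r y z) × y ≢ z
¬IsMinimal⇒below {N} r {z} ¬min
  with y , ¬[ryz⇒y≡z] ← Finₚ.¬∀⟶∃¬ N _ (λ y → T? (r y z) →-dec (y ≟ z)) ¬min
  with T? (r y z)
... | yes ryz = y , ryz , λ y≡z → ¬[ryz⇒y≡z] (λ _ → y≡z)
... | no ¬ryz = contradiction (λ ryz → contradiction ryz ¬ryz) ¬[ryz⇒y≡z]

module _ {n : ℕ} (P : FinPoset n) where

  Tuple : ℕ → Set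
  Tuple m = Vector (Subset n) m

  tupleSetoid : ℕ → Setoid 0ℓ 0ℓ
  tupleSetoid = vecSetoid (subsetSetoid n)

  _≋ₜ_ : ∀ {m} → Tuple m → Tuple m → Set
  _≋ₜ_ {m} = Setoid._≈_ (tupleSetoid m)

  _∈ₜ_ : ∀ {m} → Tuple m → List (Tuple m) → Set
  _∈ₜ_ {m} = SetoidMembership._∈_ (tupleSetoid m)

  downsetTuples : ∀ m → List (Tuple m)
  downsetTuples = allFuns (downsets P)

  downsetTuples⁺ : ∀ m → Unique (tupleSetoid m) (downsetTuples m)
  downsetTuples⁺ = allFuns⁺ (subsetSetoid n) (downsets⁺ P)

  ∈-downsetTuples : ∀ {m} {t : Tuple m} → (∀ i → Downset P (t i)) → t ∈ₜ downsetTuples m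
  ∈-downsetTuples t↓ = ∈-allFuns⁺ (subsetSetoid n) _ (λ i → ∈-downsets P (t↓ i))

  ∈-downsetTuples⁻ : ∀ {m} {t : Tuple m} → t ∈ downsetTuples m → ∀ i → Downset P (t i)
  ∈-downsetTuples⁻ t∈ i = ∈-downsets⁻ P (∈-allFuns⁻ _ t∈ i)

  Covering : ∀ {m} → Tuple m → Set
  Covering t = ∀ x → IsMinimal (le P) x → ∃ λ i → ¬ T (t i x)

  covering? : ∀ {m} (t : Tuple m) → Dec (Covering t)
  covering? t = Finₚ.all? λ x → isMinimal? (le P) x →-dec Finₚ.any? (λ i → ¬? (T? (t i x)))

  Covering-resp : ∀ {m} {t t′ : Tuple m} → t ≋ₜ t′ → Covering t → Covering t′
  Covering-resp t≋t′ cov x x-min =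
    let i , x∉ti = cov x x-min in i , λ x∈t′i → x∉ti (subst T (sym (t≋t′ i x)) x∈t′i)

  coveringCount : ℕ → ℕ
  coveringCount m = count covering? (downsetTuples m)

  module _ (m : ℕ) where

    private
      Relation : Set
      Relation = Fin (m + n) → Fin (m + n) → Bool

      _≋ᵣ_ : Relation → Relation → Set
      _≋ᵣ_ = Setoid._≈_ (relationSetoid (m + n))

    notAbove : Relation → Tuple m
    notAbove r i k = not (r (i ↑ˡ n) (m ↑ʳ k))

    IsExtension-resp : ∀ {r r′} → r ≋ᵣ r′ → IsExtension m P r → IsExtension m P r′
    IsExtension-resp {r} {r′} r≋r′ ((r-refl , r-antisym , r-trans) , restricts , new-min , old-¬min) =
      ((λ x → to (r-refl x)) , (λ x y p q → r-antisym x y (from p) (from q)) ,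
       (λ x y z p q → to (r-trans x y z (from p) (from q)))) ,
      (λ i j → trans (sym (r≋r′ _ _)) (restricts i j)) ,
      (λ i y p → new-min i y (from p)) ,
      (λ j min → old-¬min j (λ y p → min y (to p)))
      where
      to : ∀ {x y} → T (r x y) → T (r′ x y)
      to {x} {y} = subst T (r≋r′ x y)
      from : ∀ {x y} → T (r′ x y) → T (r x y)
      from {x} {y} = subst T (sym (r≋r′ x y))

    notAbove-downset : ∀ {r} → IsExtension m P r → ∀ i → Downset P (notAbove r i)
    notAbove-downset ((_ , _ , r-trans) , restricts , _) i = (λ _ _ → tt) , λ x y x∉ _ y≤x →
      T-not⁺ λ i≤y → T-not⁻ x∉ (r-trans _ _ _ i≤y (subst T (sym (restricts y x)) y≤x))

    notAbove-covering : ∀ {r} → IsExtension m P r → Covering (notAbove r)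
    notAbove-covering {r} (_ , restricts , _ , old-¬min) x x-min
      with ¬IsMinimal⇒below r (old-¬min x)
    ... | y , y≤x , y≢x with view m n y
    ...   | new i  = i , λ x∉ → T-not⁻ x∉ y≤x
    ...   | old y′ = contradiction (cong (m ↑ʳ_) (x-min y′ (subst T (restricts y′ x) y≤x))) y≢x

    -- New elements are minimal, and P fixes the order among old ones.
    notAbove-injective : ∀ {r r′} → IsExtension m P r → IsExtension m P r′ →
                         notAbove r ≋ₜ notAbove r′ → r ≋ᵣ r′
    notAbove-injective {r} {r′} ((r-refl , _) , restricts , new-min , _)
                                ((r′-refl , _) , restricts′ , new-min′ , _) eq x y
      with view m n x | view m n y
    ... | new i | new i′ = T-ext
      (λ p → subst (λ z → T (r′ z (i′ ↑ˡ n))) (sym (new-min i′ _ p)) (r′-refl _))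
      (λ p → subst (λ z → T (r z (i′ ↑ˡ n))) (sym (new-min′ i′ _ p)) (r-refl _))
    ... | new i | old k  = not-injective (eq i k)
    ... | old k | new i  = T-ext
      (λ p → contradiction (sym (new-min i _ p)) (↑ˡ≢↑ʳ i k))
      (λ p → contradiction (sym (new-min′ i _ p)) (↑ˡ≢↑ʳ i k))
    ... | old k | old k′ = trans (restricts k k′) (sym (restricts′ k k′))

    e≤coveringCount : e m P ≤ coveringCount m
    e≤coveringCount = count-≤-injection (relationSetoid (m + n)) (tupleSetoid m)
      (isExtension? m P) covering? Covering-resp {f = notAbove} (allRels⁺ (m + n))
      (λ _ ext _ ext′ → notAbove-injective ext ext′)
      (λ _ ext → ∈-downsetTuples (notAbove-downset ext) , notAbove-covering ext)

    module _ (t : Tuple m) where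

      private
        order : Fin m ⊎ Fin n → Fin m ⊎ Fin n → Bool
        order (inj₁ i) (inj₁ i′) = ⌊ i ≟ i′ ⌋
        order (inj₁ i) (inj₂ k)  = not (t i k)
        order (inj₂ _) (inj₁ _)  = false
        order (inj₂ k) (inj₂ k′) = le P k k′

        order-refl : ∀ a → T (order a a)
        order-refl (inj₁ i) = fromWitness {a? = i ≟ i} refl
        order-refl (inj₂ k) = le-refl P k

        order-antisym : ∀ a b → T (order a b) → T (order b a) → a ≡ b
        order-antisym (inj₁ i) (inj₁ i′) p _ = cong inj₁ (toWitness {a? = i ≟ i′} p)
        order-antisym (inj₂ k) (inj₂ k′) p q = cong inj₂ (le-antisym P k k′ p q)

        order-trans : (∀ i → Downset P (t i)) → ∀ a b c → T (order a b) → T (order b c) → T (order a c)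
        order-trans _  (inj₁ i) (inj₁ i′) c p q with toWitness {a? = i ≟ i′} p
        ... | refl = q
        order-trans t↓ (inj₁ i) (inj₂ k) (inj₂ k′) p q =
          T-not⁺ λ k′∈ti → T-not⁻ p (proj₂ (t↓ i) k′ k k′∈ti tt q)
        order-trans _  (inj₂ k) (inj₂ k′) (inj₂ k″) p q = le-trans P k k′ k″ p q

      extension : Relation
      extension x y = order (splitAt m x) (splitAt m y)

      extension-new-new : ∀ i i′ → extension (i ↑ˡ n) (i′ ↑ˡ n) ≡ ⌊ i ≟ i′ ⌋
      extension-new-new i i′ rewrite Finₚ.splitAt-↑ˡ m i n | Finₚ.splitAt-↑ˡ m i′ n = refl

      extension-new-old : ∀ i k → extension (i ↑ˡ n) (m ↑ʳ k) ≡ not (t i k)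
      extension-new-old i k rewrite Finₚ.splitAt-↑ˡ m i n | Finₚ.splitAt-↑ʳ m n k = refl

      extension-old-new : ∀ k i → extension (m ↑ʳ k) (i ↑ˡ n) ≡ false
      extension-old-new k i rewrite Finₚ.splitAt-↑ʳ m n k | Finₚ.splitAt-↑ˡ m i n = refl

      extension-old-old : ∀ k k′ → extension (m ↑ʳ k) (m ↑ʳ k′) ≡ le P k k′
      extension-old-old k k′ rewrite Finₚ.splitAt-↑ʳ m n k | Finₚ.splitAt-↑ʳ m n k′ = refl

      extension-isPartialOrder : (∀ i → Downset P (t i)) → IsPartialOrder extension
      extension-isPartialOrder t↓ =
        (λ x → order-refl (splitAt m x)) ,
        (λ x y p q → splitAt-injective (order-antisym (splitAt m x) (splitAt m y) p q)) ,
        (λ x y z → order-trans t↓ (splitAt m x) (splitAt m y) (splitAt m z))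
        where
        splitAt-injective : ∀ {x y} → splitAt m x ≡ splitAt m y → x ≡ y
        splitAt-injective {x} {y} eq = trans (sym (Finₚ.join-splitAt m n x))
          (trans (cong (join m n) eq) (Finₚ.join-splitAt m n y))

      extension-isExtension : (∀ i → Downset P (t i)) → Covering t → IsExtension m P extension
      extension-isExtension t↓ cov = extension-isPartialOrder t↓ , extension-old-old , new-min , old-¬min
        where
        new-min : ∀ i → IsMinimal extension (i ↑ˡ n)
        new-min i y y≤i with view m n y
        ... | new i′ = cong (_↑ˡ n) (toWitness {a? = i′ ≟ i} (subst T (extension-new-new i′ i) y≤i))
        ... | old k  = contradiction (subst T (extension-old-new k i) y≤i) λ ()
        old-¬min : ∀ k → ¬ IsMinimal extension (m ↑ʳ k)
        old-¬min k k-min with isMinimal? (le P) k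
        ... | yes k-minP = let i , k∉ti = cov k k-minP in
          ↑ˡ≢↑ʳ i k (k-min (i ↑ˡ n) (subst T (sym (extension-new-old i k)) (T-not⁺ k∉ti)))
        ... | no ¬k-minP = let y , y≤k , y≢k = ¬IsMinimal⇒below (le P) ¬k-minP in
          y≢k (Finₚ.↑ʳ-injective m y k (k-min (m ↑ʳ y) (subst T (sym (extension-old-old y k)) y≤k)))

    coveringCount≤e : coveringCount m ≤ e m P
    coveringCount≤e = count-≤-injection (tupleSetoid m) (relationSetoid (m + n))
      covering? (isExtension? m P) IsExtension-resp {f = extension} (downsetTuples⁺ m)
      (λ {t} {t′} _ _ _ _ eq i k → not-injective (trans (sym (extension-new-old t i k))
        (trans (eq (i ↑ˡ n) (m ↑ʳ k)) (extension-new-old t′ i k))))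
      (λ {t} t∈ cov → ∈-allRels (extension t) ,
        extension-isExtension t (∈-downsetTuples⁻ t∈) cov)

    e≡coveringCount : e m P ≡ coveringCount m
    e≡coveringCount = ≤-antisym e≤coveringCount coveringCount≤e

  d*coveringCount≤coveringCount-suc : ∀ m → d P * coveringCount m ≤ coveringCount (suc m)
  d*coveringCount≤coveringCount-suc m = begin
    d P * coveringCount m  ≡⟨ length-cartesianProductWith _,_ (downsets P) covering ⟨
    length pairs           ≤⟨ length-≤-injection pairSetoid (tupleSetoid (suc m)) unique inj into ⟩
    coveringCount (suc m)  ∎
    where
    open ≤-Reasoning
    covering = filter covering? (downsetTuples m)
    pairs = cartesianProduct (downsets P) covering
    pairSetoid = subsetSetoid n ×ₛ tupleSetoid m

    unique : Unique pairSetoid pairs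
    unique = Unique.cartesianProduct⁺ (subsetSetoid n) (tupleSetoid m) (downsets⁺ P)
      (Unique.filter⁺ (tupleSetoid m) covering? (downsetTuples⁺ m))

    inj : ∀ {St St′} → St ∈ pairs → St′ ∈ pairs →
          (proj₁ St ∷ᵛ proj₂ St) ≋ₜ (proj₁ St′ ∷ᵛ proj₂ St′) → Setoid._≈_ pairSetoid St St′
    inj _ _ eq = eq fzero , λ i → eq (fsuc i)

    into : ∀ {St} → St ∈ pairs → (proj₁ St ∷ᵛ proj₂ St) ∈ₜ filter covering? (downsetTuples (suc m))
    into {S , t} St∈
      with S∈ , t∈ ← Membershipₚ.∈-cartesianProduct⁻ (downsets P) covering St∈
      with t∈′ , cov ← Membershipₚ.∈-filter⁻ covering? {xs = downsetTuples m} t∈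
      = SetoidMembershipₚ.∈-filter⁺ (tupleSetoid (suc m)) covering? Covering-resp
          (∈-downsetTuples λ { fzero → ∈-downsets⁻ P S∈ ; (fsuc i) → ∈-downsetTuples⁻ t∈′ i })
          (λ x x-min → let i , x∉ti = cov x x-min in fsuc i , x∉ti)

  coveringCount≤d^ : ∀ m → coveringCount m ≤ d P ^ m
  coveringCount≤d^ m = ≤-trans (length-filter covering? (downsetTuples m))
    (≤-reflexive (length-allFuns (downsets P) m))

  Uncovered : ∀ {m} → Tuple m → Fin n → Set
  Uncovered t x = IsMinimal (le P) x × (∀ i → T (t i x))

  uncovered? : ∀ {m} (t : Tuple m) x → Dec (Uncovered t x)
  uncovered? t x = isMinimal? (le P) x ×-dec Finₚ.all? (λ i → T? (t i x))

  ¬Covering⇒uncovered : ∀ {m} {t : Tuple m} → ¬ Covering t → ∃ (Uncovered t)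
  ¬Covering⇒uncovered {t = t} ¬cov
    with x , ¬[min⇒avoided] ← Finₚ.¬∀⟶∃¬ n _
                                (λ x → isMinimal? (le P) x →-dec Finₚ.any? (λ i → ¬? (T? (t i x)))) ¬cov
    = x , decidable-stable (isMinimal? (le P) x) (λ ¬min → ¬[min⇒avoided] λ min → contradiction min ¬min) ,
      λ i → decidable-stable (T? (t i x)) λ x∉ti → ¬[min⇒avoided] λ _ → i , x∉ti

  allBut : Fin n → Subset n
  allBut x y = not ⌊ y ≟ x ⌋

  x∉allBut : ∀ x → ¬ T (allBut x x)
  x∉allBut x with x ≟ x
  ... | yes _ = λ ()
  ... | no x≢x = contradiction refl x≢x

  remove : Fin n → Subset n → Subset n
  remove x S y = S y ∧ allBut x y

  remove-injective : ∀ {x x′ S S′} → x ≡ x′ → T (S x) → T (S′ x′) → remove x S ≋ remove x′ S′ → S ≋ S′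
  remove-injective {x} {_} {S} {S′} refl Sx S′x eq y with y ≟ x | eq y
  ... | yes refl | _ = T-ext (λ _ → S′x) (λ _ → Sx)
  ... | no  _      | e = trans (sym (∧-identityʳ (S y))) (trans e (∧-identityʳ (S′ y)))

  remove-downset : ∀ {x S} → Downset P S → IsDownsetOn P (allBut x) (remove x S)
  remove-downset {x} {S} (_ , S-closed) =
    (λ y y∈ → proj₂ (Equivalence.to T-∧ y∈)) ,
    λ y z y∈ z∈A z≤y → Equivalence.from T-∧ (S-closed y z (proj₁ (Equivalence.to T-∧ y∈)) tt z≤y , z∈A)

  noncoveringCount≤ : ∀ m → Fin n → count (∁? covering?) (downsetTuples m) ≤ mP P * d′ P ^ m
  noncoveringCount≤ m x₀ = begin
    count (∁? covering?) (downsetTuples m) ≤⟨ length-≤-injection (tupleSetoid m) pairSetoid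
                                                (Unique.filter⁺ (tupleSetoid m) (∁? covering?) (downsetTuples⁺ m)) inj into ⟩
    length (concatMap restricted minimals)  ≤⟨ length-concatMap-≤ restricted length-restricted minimals ⟩
    mP P * d′ P ^ m                         ∎
    where
    open ≤-Reasoning
    pairSetoid = ≡.setoid (Fin n) ×ₛ tupleSetoid m
    minimals = filter (isMinimal? (le P)) (allFin n)

    downsetsOn : Fin n → List (Subset n)
    downsetsOn x = filter (isDownsetOn? P (allBut x)) (allSubsets n)

    restricted : Fin n → List (Fin n × Tuple m)
    restricted x = map (x ,_) (allFuns (downsetsOn x) m)

    length-restricted : ∀ x → length (restricted x) ≤ d′ P ^ m
    length-restricted x = ≤-trans
      (≤-reflexive (trans (length-map (x ,_) (allFuns (downsetsOn x) m)) (length-allFuns (downsetsOn x) m)))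
      (^-monoˡ-≤ m (dOn≤d′ P (allBut x) (x∉allBut x)))

    -- x₀ is only a default, taken on covering tuples, where the choice is irrelevant.
    chosen : Tuple m → Fin n
    chosen t with Finₚ.any? (uncovered? t)
    ... | yes (x , _) = x
    ... | no  _       = x₀

    chosen-uncovered : ∀ {t} → ¬ Covering t → Uncovered t (chosen t)
    chosen-uncovered {t} ¬cov with Finₚ.any? (uncovered? t)
    ... | yes (_ , unc) = unc
    ... | no  none      = contradiction (¬Covering⇒uncovered ¬cov) none

    encode : Tuple m → Fin n × Tuple m
    encode t = chosen t , λ i → remove (chosen t) (t i)

    noncovering : ∀ {t} → t ∈ filter (∁? covering?) (downsetTuples m) → t ∈ downsetTuples m × ¬ Covering t
    noncovering = Membershipₚ.∈-filter⁻ (∁? covering?) {xs = downsetTuples m}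

    inj : ∀ {t t′} → t ∈ filter (∁? covering?) (downsetTuples m) → t′ ∈ filter (∁? covering?) (downsetTuples m) →
          Setoid._≈_ pairSetoid (encode t) (encode t′) → t ≋ₜ t′
    inj t∈ t′∈ (x≡x′ , eq) i = remove-injective x≡x′
      (proj₂ (chosen-uncovered (proj₂ (noncovering t∈))) i)
      (proj₂ (chosen-uncovered (proj₂ (noncovering t′∈))) i)
      (eq i)

    removed∈ : ∀ {x t} → t ∈ downsetTuples m → (λ i → remove x (t i)) ∈ₜ allFuns (downsetsOn x) m
    removed∈ {x} t∈ = ∈-allFuns⁺ (subsetSetoid n) m λ i →
      SetoidMembershipₚ.∈-filter⁺ (subsetSetoid n) (isDownsetOn? P (allBut x)) (IsDownsetOn-resp P (λ _ → refl))
        (∈-allSubsets _) (remove-downset (∈-downsetTuples⁻ t∈ i))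

    chosen∈minimals : ∀ {t} → ¬ Covering t → chosen t ∈ minimals
    chosen∈minimals ¬cov =
      Membershipₚ.∈-filter⁺ (isMinimal? (le P)) (Membershipₚ.∈-allFin _) (proj₁ (chosen-uncovered ¬cov))

    into : ∀ {t} → t ∈ filter (∁? covering?) (downsetTuples m) →
           SetoidMembership._∈_ pairSetoid (encode t) (concatMap restricted minimals)
    into t∈ with t∈′ , ¬cov ← noncovering t∈ =
      Anyₚ.concat⁺ (Anyₚ.map⁺ (Any.map (λ { refl → Anyₚ.map⁺ (Any.map (refl ,_) (removed∈ t∈′)) })
                                       (chosen∈minimals ¬cov)))

  d^≤coveringCount+mP*d′^ : ∀ m → Fin n → d P ^ m ≤ coveringCount m + mP P * d′ P ^ m
  d^≤coveringCount+mP*d′^ m x₀ = begin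
    d P ^ m                                                  ≡⟨ length-allFuns (downsets P) m ⟨
    length (downsetTuples m)                                 ≡⟨ length≡count+count∁ covering? (downsetTuples m) ⟩
    coveringCount m + count (∁? covering?) (downsetTuples m) ≤⟨ +-monoʳ-≤ (coveringCount m) (noncoveringCount≤ m x₀) ⟩
    coveringCount m + mP P * d′ P ^ m                        ∎
    where open ≤-Reasoning

-- Lower bounds for (1 + 1/t)^m

bernoulli : ∀ t r → t ^ r * (t + r) ≤ t * suc t ^ r
bernoulli t zero    = ≤-reflexive (lemma t)
  where lemma : ∀ t → 1 * (t + 0) ≡ t * 1
        lemma = solve-∀
bernoulli t (suc r) = begin
  t * x * (t + suc r)         ≡⟨ l₁ t x r ⟩
  x * (t + r) * t + x * t     ≤⟨ +-monoʳ-≤ (x * (t + r) * t) (*-monoʳ-≤ x (m≤m+n t r)) ⟩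
  x * (t + r) * t + x * (t + r) ≡⟨ l₂ t x r ⟩
  suc t * (x * (t + r))       ≤⟨ *-monoʳ-≤ (suc t) (bernoulli t r) ⟩
  suc t * (t * suc t ^ r)     ≡⟨ l₃ t (suc t ^ r) ⟩
  t * (suc t * suc t ^ r)     ∎
  where
  open ≤-Reasoning
  x = t ^ r
  l₁ : ∀ t x r → t * x * (t + suc r) ≡ x * (t + r) * t + x * t
  l₁ = solve-∀
  l₂ : ∀ t x r → x * (t + r) * t + x * (t + r) ≡ suc t * (x * (t + r))
  l₂ = solve-∀
  l₃ : ∀ t y → suc t * (t * y) ≡ t * (suc t * y)
  l₃ = solve-∀

infix 4 _≤[1+1/_]^_

-- c ≤ (1 + 1/t)^m, with the denominators cleared.
record _≤[1+1/_]^_ (c t m : ℕ) : Set where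
  constructor cleared
  field uncleared : c * t ^ m ≤ suc t ^ m
open _≤[1+1/_]^_

≤[1+1/]^-mono : ∀ {c t a b} → a ≤ b → c ≤[1+1/ t ]^ a → c ≤[1+1/ t ]^ b
≤[1+1/]^-mono {c} {t} {a} a≤b (cleared c≤) with r , refl ← m≤n⇒∃[o]m+o≡n a≤b = cleared (begin
  c * t ^ (a + r)           ≡⟨ cong (c *_) (^-distribˡ-+-* t a r) ⟩
  c * (t ^ a * t ^ r)       ≡⟨ *-assoc c (t ^ a) (t ^ r) ⟨
  c * t ^ a * t ^ r         ≤⟨ *-mono-≤ c≤ (^-monoˡ-≤ r (n≤1+n t)) ⟩
  suc t ^ a * suc t ^ r     ≡⟨ ^-distribˡ-+-* (suc t) a r ⟨
  suc t ^ (a + r)           ∎)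
  where open ≤-Reasoning

≤[1+1/]^-weaken : ∀ {c c′ t m} → c′ ≤ c → c ≤[1+1/ t ]^ m → c′ ≤[1+1/ t ]^ m
≤[1+1/]^-weaken {t = t} {m} c′≤c (cleared c≤) = cleared (≤-trans (*-monoˡ-≤ (t ^ m) c′≤c) c≤)

≤[1+1/]^-* : ∀ {c c′ t a b} → c ≤[1+1/ t ]^ a → c′ ≤[1+1/ t ]^ b → c * c′ ≤[1+1/ t ]^ (a + b)
≤[1+1/]^-* {c} {c′} {t} {a} {b} (cleared c≤) (cleared c′≤) = cleared (begin
  c * c′ * t ^ (a + b)       ≡⟨ cong (c * c′ *_) (^-distribˡ-+-* t a b) ⟩
  c * c′ * (t ^ a * t ^ b)   ≡⟨ lemma c c′ (t ^ a) (t ^ b) ⟩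
  c * t ^ a * (c′ * t ^ b)   ≤⟨ *-mono-≤ c≤ c′≤ ⟩
  suc t ^ a * suc t ^ b      ≡⟨ ^-distribˡ-+-* (suc t) a b ⟨
  suc t ^ (a + b)            ∎)
  where
  open ≤-Reasoning
  lemma : ∀ c c′ x y → c * c′ * (x * y) ≡ c * x * (c′ * y)
  lemma = solve-∀

1≤[1+1/]^ : ∀ {t m} → 1 ≤[1+1/ t ]^ m
1≤[1+1/]^ {t} {m} = cleared (≤-trans (≤-reflexive (*-identityˡ (t ^ m))) (^-monoˡ-≤ m (n≤1+n t)))

doubling : ∀ t → 2 ≤[1+1/ t ]^ suc t
doubling zero      = cleared z≤n
doubling t@(suc _) = cleared (*-cancelˡ-≤ t (begin
  t * (2 * x)          ≡⟨ lemma t x ⟩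
  x * (t + t)          ≤⟨ *-monoʳ-≤ x (+-monoʳ-≤ t (n≤1+n t)) ⟩
  x * (t + suc t)      ≤⟨ bernoulli t (suc t) ⟩
  t * suc t ^ suc t    ∎))
  where
  open ≤-Reasoning
  x = t ^ suc t
  lemma : ∀ t x → t * (2 * x) ≡ x * (t + t)
  lemma = solve-∀

quadrupling : ∀ t → 4 ≤[1+1/ t ]^ (2 * suc t)
quadrupling t rewrite +-identityʳ (suc t) = ≤[1+1/]^-* (doubling t) (doubling t)

threeHalves : ∀ t r → 2 * suc t ≤ 3 * r → 3 * t ^ r ≤ 2 * suc t ^ r
threeHalves zero      zero    ()
threeHalves zero      (suc r) _ = z≤n
threeHalves t@(suc _) r h = *-cancelˡ-≤ t (begin
  t * (3 * x)          ≡⟨ l₁ t x ⟩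
  x * (3 * t)          ≤⟨ *-monoʳ-≤ x 3t≤2[t+r] ⟩
  x * (2 * (t + r))    ≡⟨ l₂ x t r ⟩
  2 * (x * (t + r))    ≤⟨ *-monoʳ-≤ 2 (bernoulli t r) ⟩
  2 * (t * suc t ^ r)  ≡⟨ l₃ t (suc t ^ r) ⟩
  t * (2 * suc t ^ r)  ∎)
  where
  open ≤-Reasoning
  x = t ^ r
  l₁ : ∀ t x → t * (3 * x) ≡ x * (3 * t)
  l₁ = solve-∀
  l₂ : ∀ x t r → x * (2 * (t + r)) ≡ 2 * (x * (t + r))
  l₂ = solve-∀
  l₃ : ∀ t y → 2 * (t * y) ≡ t * (2 * y)
  l₃ = solve-∀
  3t≤2[t+r] : 3 * t ≤ 2 * (t + r)
  3t≤2[t+r] = begin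
    3 * t         ≡⟨ l₄ t ⟩
    t + 2 * t     ≤⟨ +-monoˡ-≤ (2 * t) t≤2r ⟩
    2 * r + 2 * t ≡⟨ l₅ r t ⟩
    2 * (t + r)   ∎
    where
    l₄ : ∀ t → 3 * t ≡ t + 2 * t
    l₄ = solve-∀
    l₅ : ∀ r t → 2 * r + 2 * t ≡ 2 * (t + r)
    l₅ = solve-∀
    t≤2r : t ≤ 2 * r
    t≤2r = *-cancelˡ-≤ 2 (begin
      2 * t       ≤⟨ *-monoʳ-≤ 2 (n≤1+n t) ⟩
      2 * suc t   ≤⟨ h ⟩
      3 * r       ≤⟨ *-monoˡ-≤ r (n≤1+n 3) ⟩
      4 * r       ≡⟨ *-assoc 2 2 r ⟩
      2 * (2 * r) ∎)

split-exponent : ∀ {P : ℕ → Set} a b {m} → 3 * a + b ≤ 3 * m → (∀ r → b ≤ 3 * r → P (a + r)) → P m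
split-exponent a b {m} h k
  with r , refl ← m≤n⇒∃[o]m+o≡n {a} {m} (*-cancelˡ-≤ 3 (≤-trans (m≤m+n (3 * a) b) h)) =
  k r (+-cancelˡ-≤ (3 * a) b (3 * r) (≤-trans h (≤-reflexive (*-distribˡ-+ 3 a r))))

-- Each further 2(t + 1) in the exponent multiplies the bound by 4, which pays for raising k by 3;
-- for k = 3 the remaining exponent is only worth 3/2, via Bernoulli's inequality.
2k≤[1+1/]^ : ∀ k t m → 2 * suc k * suc t ≤ 3 * m → 2 * k ≤[1+1/ t ]^ m
2k≤[1+1/]^ 0 t m _ = cleared z≤n
2k≤[1+1/]^ 1 t m h = split-exponent {2 ≤[1+1/ t ]^_} (suc t) (suc t) (≤-trans (≤-reflexive (lemma t)) h)
  λ _ _ → ≤[1+1/]^-* (doubling t) 1≤[1+1/]^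
  where
  lemma : ∀ t → 3 * suc t + suc t ≡ 2 * 2 * suc t
  lemma = solve-∀
2k≤[1+1/]^ 2 t m h = split-exponent {4 ≤[1+1/ t ]^_} (2 * suc t) 0 (≤-trans (≤-reflexive (lemma t)) h)
  λ _ _ → ≤[1+1/]^-* (quadrupling t) 1≤[1+1/]^
  where
  lemma : ∀ t → 3 * (2 * suc t) + 0 ≡ 2 * 3 * suc t
  lemma = solve-∀
2k≤[1+1/]^ 3 t m h = split-exponent {6 ≤[1+1/ t ]^_} a a (≤-trans (≤-reflexive (lemma t)) h)
  λ r 2[t+1]≤3r → cleared (*-cancelˡ-≤ 2 (begin
    2 * (6 * t ^ (a + r))        ≡⟨ cong (λ x → 2 * (6 * x)) (^-distribˡ-+-* t a r) ⟩
    2 * (6 * (t ^ a * t ^ r))    ≡⟨ regroup (t ^ a) (t ^ r) ⟩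
    4 * t ^ a * (3 * t ^ r)      ≤⟨ *-mono-≤ (uncleared (quadrupling t)) (threeHalves t r 2[t+1]≤3r) ⟩
    suc t ^ a * (2 * suc t ^ r)  ≡⟨ ungroup (suc t ^ a) (suc t ^ r) ⟩
    2 * (suc t ^ a * suc t ^ r)  ≡⟨ cong (2 *_) (^-distribˡ-+-* (suc t) a r) ⟨
    2 * suc t ^ (a + r)          ∎))
  where
  open ≤-Reasoning
  a = 2 * suc t
  lemma : ∀ t → 3 * (2 * suc t) + 2 * suc t ≡ 2 * 4 * suc t
  lemma = solve-∀
  regroup : ∀ x y → 2 * (6 * (x * y)) ≡ 4 * x * (3 * y)
  regroup = solve-∀
  ungroup : ∀ x y → x * (2 * y) ≡ 2 * (x * y)
  ungroup = solve-∀
2k≤[1+1/]^ (suc (suc (suc (suc k)))) t m h =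
  split-exponent {2 * (4 + k) ≤[1+1/ t ]^_} (2 * suc t) (2 * suc (suc k) * suc t)
    (≤-trans (≤-reflexive (lemma k t)) h)
    λ r h′ → ≤[1+1/]^-weaken (≤-trans (m≤m+n (2 * (4 + k)) (6 * k)) (≤-reflexive (sym (8+8k k))))
               (≤[1+1/]^-* (quadrupling t) (2k≤[1+1/]^ (suc k) t r h′))
  where
  lemma : ∀ k t → 3 * (2 * suc t) + 2 * suc (suc k) * suc t ≡ 2 * (5 + k) * suc t
  lemma = solve-∀
  8+8k : ∀ k → 4 * (2 * suc k) ≡ 2 * (4 + k) + 6 * k
  8+8k = solve-∀

n<2^n : ∀ n → n < 2 ^ n
n<2^n zero    = s≤s z≤n
n<2^n (suc n) = begin
  2 + n         ≤⟨ s≤s (m≤n+m (suc n) n) ⟩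
  suc n + suc n ≤⟨ +-mono-≤ (n<2^n n) (n<2^n n) ⟩
  2 ^ n + 2 ^ n ≡⟨ cong (2 ^ n +_) (+-identityʳ (2 ^ n)) ⟨
  2 ^ suc n     ∎
  where open ≤-Reasoning

k*a+k*2^k*b≤2^k*a : ∀ k {a b} → 2 * k * b ≤ a → k * a + k * 2 ^ k * b ≤ 2 ^ k * a
k*a+k*2^k*b≤2^k*a zero    _ = z≤n
k*a+k*2^k*b≤2^k*a (suc k) {a} {b} 2kb≤a = begin
  suc k * a + suc k * (2 * c) * b  ≡⟨ cong (suc k * a +_) (reassoc (suc k) c b) ⟩
  suc k * a + c * (2 * suc k * b)  ≤⟨ +-mono-≤ (*-monoˡ-≤ a (n<2^n k)) (*-monoʳ-≤ c 2kb≤a) ⟩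
  c * a + c * a                    ≡⟨ double c a ⟩
  2 * c * a                        ∎
  where
  open ≤-Reasoning
  c = 2 ^ k
  reassoc : ∀ k c b → k * (2 * c) * b ≡ c * (2 * k * b)
  reassoc = solve-∀
  double : ∀ c a → c * a + c * a ≡ 2 * c * a
  double = solve-∀

square≤ : ∀ k {a b c} → a ≤ c + k * b → 2 * k * b ≤ a → a * a ≤ c * (a + 2 ^ k * b)
square≤ k {a} {b} {c} a≤c+kb 2kb≤a = +-cancelʳ-≤ (a * (x * b)) (a * a) (c * s) (begin
  a * a + a * (x * b)               ≡⟨ *-distribˡ-+ a a (x * b) ⟨
  a * s                             ≤⟨ *-monoˡ-≤ s a≤c+kb ⟩
  (c + k * b) * s                   ≡⟨ expand c k b a x ⟩
  c * s + b * (k * a + k * x * b)   ≤⟨ +-monoʳ-≤ (c * s) (*-monoʳ-≤ b (k*a+k*2^k*b≤2^k*a k 2kb≤a)) ⟩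
  c * s + b * (x * a)               ≡⟨ cong (c * s +_) (swap b x a) ⟩
  c * s + a * (x * b)               ∎)
  where
  open ≤-Reasoning
  x = 2 ^ k
  s = a + x * b
  expand : ∀ c k b a x → (c + k * b) * (a + x * b) ≡ c * (a + x * b) + b * (k * a + k * x * b)
  expand = solve-∀
  swap : ∀ b x a → b * (x * a) ≡ a * (x * b)
  swap = solve-∀

ratio-bound : ∀ d d′ k e₀ e₁ m → d′ < d → 2 * suc k * d ≤ 3 * m →
              e₁ ≤ d ^ suc m → d ^ m ≤ e₀ + k * d′ ^ m →
              e₁ * d ^ m ≤ d * e₀ * (d ^ m + 2 ^ k * d′ ^ m)
ratio-bound d@(suc t) d′ k e₀ e₁ m (s≤s d′≤t) k-small e₁≤d·a a≤e₀+kb = begin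
  e₁ * a                     ≤⟨ *-monoˡ-≤ a e₁≤d·a ⟩
  d * a * a                  ≡⟨ *-assoc d a a ⟩
  d * (a * a)                ≤⟨ *-monoʳ-≤ d (square≤ k a≤e₀+kb 2kb≤a) ⟩
  d * (e₀ * (a + 2 ^ k * b)) ≡⟨ *-assoc d e₀ _ ⟨
  d * e₀ * (a + 2 ^ k * b)   ∎
  where
  open ≤-Reasoning
  a = d ^ m
  b = d′ ^ m
  2kb≤a : 2 * k * b ≤ a
  2kb≤a = ≤-trans (*-monoʳ-≤ (2 * k) (^-monoˡ-≤ m d′≤t)) (uncleared (2k≤[1+1/]^ k t m k-small))

LnTwoTimesLe⇒2x≤3m : ∀ x m → LnTwoTimesLe x m → 2 * x ≤ 3 * m
LnTwoTimesLe⇒2x≤3m x m x·ln2≤m = ℤₚ.drop‿+≤+ (subst₂ ℤ._≤_ (lhs x) (rhs m) (ℚᵘₚ.drop-*≤* x·⅔≤m))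
  where
  open ℤ using (+_)
  x·⅔≤m : mkℚᵘ (+ x) 0 ℚᵘ.* mkℚᵘ (+ 2) 2 ℚᵘ.≤ mkℚᵘ (+ m) 0
  x·⅔≤m = ℚᵘₚ.≤-respʳ-≃ (ℚₚ.toℚᵘ-fromℚᵘ (mkℚᵘ (+ m) 0))
    (ℚᵘₚ.≤-respˡ-≃ (ℚᵘₚ.≃-trans (ℚₚ.toℚᵘ-homo-* (+ x ℚ./ 1) (lnTwoPartial 3))
                                (ℚᵘₚ.*-congʳ (ℚₚ.toℚᵘ-fromℚᵘ (mkℚᵘ (+ x) 0))))
                   (ℚₚ.toℚᵘ-mono-≤ (x·ln2≤m 3)))
  lhs : ∀ x → (+ x ℤ.* + 2) ℤ.* + 1 ≡ + (2 * x)
  lhs x = trans (ℤₚ.*-identityʳ _) (trans (sym (ℤₚ.pos-* x 2)) (cong +_ (*-comm x 2)))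
  rhs : ∀ m → + m ℤ.* + 3 ≡ + (3 * m)
  rhs m = trans (sym (ℤₚ.pos-* m 3)) (cong +_ (*-comm m 3))

theorem6p3 : ∀ {n} → (P : FinPoset (suc n)) →
               (d′ P + 1 ≤ d P) ×
               (∀ (m : ℕ) → LnTwoTimesLe ((mP P + 1) * d P) m →
                  (d P * e m P ≤ e (suc m) P) ×
                  (e (suc m) P * d P ^ m ≤ d P * e m P * (d P ^ m + 2 ^ mP P * d′ P ^ m)))
theorem6p3 P = d′+1≤d , λ m x·ln2≤m →
  d*e≤e-suc m ,
  ratio-bound (d P) (d′ P) (mP P) (e m P) (e (suc m) P) m
    (d′<d P) (large m x·ln2≤m) (e≤d^ (suc m)) (d^≤e+mP*d′^ m)
  where
  d′+1≤d : d′ P + 1 ≤ d P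
  d′+1≤d = subst (_≤ d P) (+-comm 1 (d′ P)) (d′<d P)

  large : ∀ m → LnTwoTimesLe ((mP P + 1) * d P) m → 2 * suc (mP P) * d P ≤ 3 * m
  large m x·ln2≤m = subst (_≤ 3 * m) (reorder (mP P) (d P)) (LnTwoTimesLe⇒2x≤3m ((mP P + 1) * d P) m x·ln2≤m)
    where
    reorder : ∀ k d → 2 * ((k + 1) * d) ≡ 2 * suc k * d
    reorder = solve-∀

  d*e≤e-suc : ∀ m → d P * e m P ≤ e (suc m) P
  d*e≤e-suc m rewrite e≡coveringCount P m | e≡coveringCount P (suc m) = d*coveringCount≤coveringCount-suc P m

  e≤d^ : ∀ m → e m P ≤ d P ^ m
  e≤d^ m rewrite e≡coveringCount P m = coveringCount≤d^ P m

  d^≤e+mP*d′^ : ∀ m → d P ^ m ≤ e m P + mP P * d′ P ^ m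
  d^≤e+mP*d′^ m rewrite e≡coveringCount P m = d^≤coveringCount+mP*d′^ P m fzero
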